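{- For every integer $m\ge1$, every term $w_1\otimes\cdots\otimes w_{m+1}$ of $Y\cdot P^m\cdot Y\in B^{\otimes(m+1)}$ has $w_{m+1}\in\{X,Y\}$.
   Context: Let $\mathcal M=\mathbb Z\langle y,n\rangle/(yn=ny=n,\ n^2=0,\ y^2=y)$. In the ring $\mathcal M\otimes\mathcal M$ (tensor over $\mathbb Z$, with $(a\otimes b)(c\otimes d)=ac\otimes bd$) put $X=y\otimes n+n\otimes y$, $Y=y\otimes y$, $Z=n\otimes n$, and let $B$ be the $\mathbb Z$-span of $X,Y,Z$: a commutative subring, free abelian with basis $X,Y,Z$, with $X^2=2Z$, $Y^2=Y$, $Z^2=0$, $XY=YX=X$, $XZ=ZX=0$, $YZ=ZY=Z$. For $r\ge1$, $B^{\otimes r}$ is free abelian with basis the words $w_1\otimes\cdots\otimes w_r$, $w_i\in\{X,Y,Z\}$; writing $u\in B^{\otimes r}$ uniquely as $\sum_w c_w w$, a term of $u$ is a word $w$ with $c_w\ne0$, and $c_w$ is its coefficient. The chaining product $B^{\otimes r}\times B^{\otimes s}\to B^{\otimes(r+s-1)}$ is the bilinear (associative) map $(a_1\otimes\cdots\otimes a_r)\cdot(b_1\otimes\cdots\otimes b_s)=a_1\otimes\cdots\otimes a_{r-1}\otimes(a_rb_1)\otimes b_2\otimes\cdots\otimes b_s$. Elements of $B$ are regarded as elements of $B^{\otimes1}$. Let $P=X\otimes Y+Y\otimes X\in B^{\otimes2}$ and let $P^m\in B^{\otimes(m+1)}$ be its $m$-fold chaining product. -}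

module Defs where

open import Data.Nat using (ℕ; zero; suc; _+_)
open import Data.Integer using (ℤ; +_; 0ℤ; 1ℤ) renaming (_+_ to _+ℤ_; _*_ to _*ℤ_)
open import Data.List using (List; []; _∷_; map; concatMap; _++_)
open import Data.Product using (_×_; _,_)
open import Data.Vec using (Vec; []; _∷_)
open import Relation.Nullary using (yes; no)
open import Relation.Binary.PropositionalEquality using (_≡_; refl)
open import Relation.Binary using (DecidableEquality)
import Data.Vec.Properties as VecP

-- Basis of B = ℤ-span of X, Y, Z.
data Gen : Set where
  X Y Z : Gen

_≟G_ : DecidableEquality Gen
X ≟G X = yes refl
X ≟G Y = no λ ()
X ≟G Z = no λ ()
Y ≟G X = no λ ()
Y ≟G Y = yes refl
Y ≟G Z = no λ ()
Z ≟G X = no λ ()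
Z ≟G Y = no λ ()
Z ≟G Z = yes refl

-- An element of B as a formal ℤ-linear combination (list of coefficient/basis pairs).
-- Product of basis elements in B:
-- X²=2Z, Y²=Y, Z²=0, XY=YX=X, XZ=ZX=0, YZ=ZY=Z.
mulGen : Gen → Gen → List (ℤ × Gen)
mulGen X X = (+ 2 , Z) ∷ []
mulGen X Y = (1ℤ , X) ∷ []
mulGen X Z = []
mulGen Y X = (1ℤ , X) ∷ []
mulGen Y Y = (1ℤ , Y) ∷ []
mulGen Y Z = (1ℤ , Z) ∷ []
mulGen Z X = []
mulGen Z Y = (1ℤ , Z) ∷ []
mulGen Z Z = []

-- An element of B^{⊗(n+1)}: a formal ℤ-linear combination of words of length n+1.
Tens : ℕ → Set
Tens n = List (ℤ × Vec Gen (suc n))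

-- Chaining product of two words a₁⊗…⊗a_{r+1} and b₁⊗…⊗b_{s+1}:
-- a₁⊗…⊗a_r⊗(a_{r+1} b₁)⊗b₂⊗…⊗b_{s+1}, expanded in the word basis.
chainW : {r s : ℕ} → Vec Gen (suc r) → Vec Gen (suc s) → List (ℤ × Vec Gen (suc (r + s)))
chainW {zero} (a ∷ []) (b ∷ bs) = map (λ { (c , g) → (c , g ∷ bs) }) (mulGen a b)
chainW {suc r} (a ∷ as) bs = map (λ { (c , w) → (c , a ∷ w) }) (chainW as bs)

chain : {r s : ℕ} → Tens r → Tens s → Tens (r + s)
chain u v = concatMap (λ { (c , a) → concatMap (λ { (d , b) →
              map (λ { (e , w) → (c *ℤ d *ℤ e , w) }) (chainW a b) }) v }) u

Yt : Tens 0
Yt = (1ℤ , Y ∷ []) ∷ []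

P : Tens 1
P = (1ℤ , X ∷ Y ∷ []) ∷ (1ℤ , Y ∷ X ∷ []) ∷ []

-- P^m ∈ B^{⊗(m+1)}, the m-fold chaining product (P^0 := Y, the unit; only m ≥ 1 is used).
Ppow : (m : ℕ) → Tens m
Ppow zero = Yt
Ppow (suc m) = chain P (Ppow m)

coeff : {n : ℕ} → Tens n → Vec Gen (suc n) → ℤ
coeff [] w = 0ℤ
coeff ((c , v) ∷ u) w with VecP.≡-dec _≟G_ v w
... | yes _ = c +ℤ coeff u w
... | no _ = coeff u w

-- Y is a unit of B, so chaining a word with Y on the right changes none of its letters, while
-- a chaining product whose right factor has length at least two keeps that factor's last
-- letter.  Hence every word of P^m ends in the last letter of a word of P, that is in X or Y,
-- and so does every word of Y · P^m · Y.
module Submission where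

open import Defs
open import Data.Nat using (ℕ; suc; zero; _≤_; _+_)
open import Data.Integer using (0ℤ; 1ℤ)
open import Data.Vec using (Vec; last; []; _∷_)
open import Data.List using (List; []; _∷_; concatMap)
open import Data.List.Relation.Unary.All as All using (All; []; _∷_)
open import Data.List.Relation.Unary.All.Properties using (map⁺; concat⁺)
open import Data.Product using (proj₂; _,_)
open import Data.Sum using (_⊎_; inj₁; inj₂)
open import Data.Unit using (⊤)
open import Function using (_∘_)
open import Relation.Nullary using (yes; no; contradiction)
open import Relation.Binary.PropositionalEquality using (_≡_; _≢_; refl; sym; subst)
import Data.Vec.Properties as VecP

AllWords : ∀ {n} → (Vec Gen (suc n) → Set) → Tens n → Set
AllWords Q = All (Q ∘ proj₂)

AllWords-coeff≢0 : ∀ {n} {Q : Vec Gen (suc n) → Set} {u : Tens n} {w : Vec Gen (suc n)} →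
  AllWords Q u → coeff u w ≢ 0ℤ → Q w
AllWords-coeff≢0 {u = []} [] c≢0 = contradiction refl c≢0
AllWords-coeff≢0 {u = (_ , v) ∷ _} {w} (Qv ∷ Qu) c≢0 with VecP.≡-dec _≟G_ v w
... | yes refl = Qv
... | no _ = AllWords-coeff≢0 Qu c≢0

concatMap⁺ : ∀ {A B : Set} {P : A → Set} {Q : B → Set} {f : A → List B} {xs : List A} →
  (∀ {x} → P x → All Q (f x)) → All P xs → All Q (concatMap f xs)
concatMap⁺ h = concat⁺ ∘ map⁺ ∘ All.map h

chain-AllWords : ∀ {r s} {U : Vec Gen (suc r) → Set} {V : Vec Gen (suc s) → Set}
  {R : Vec Gen (suc (r + s)) → Set} →
  (∀ {a b} → U a → V b → AllWords R (chainW a b)) →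
  ∀ {u v} → AllWords U u → AllWords V v → AllWords R (chain u v)
chain-AllWords h Uu Vv = concatMap⁺ (λ Ua → concatMap⁺ (λ Vb → map⁺ (h Ua Vb)) Vv) Uu

mulGen-identityʳ : ∀ g → mulGen g Y ≡ (1ℤ , g) ∷ []
mulGen-identityʳ X = refl
mulGen-identityʳ Y = refl
mulGen-identityʳ Z = refl

chainW-identityʳ-last : ∀ {r} (a : Vec Gen (suc r)) →
  AllWords (λ w → last w ≡ last a) (chainW a (Y ∷ []))
chainW-identityʳ-last {zero} (a ∷ []) rewrite mulGen-identityʳ a = refl ∷ []
chainW-identityʳ-last {suc r} (_ ∷ as) = map⁺ (chainW-identityʳ-last as)

chainW-last : ∀ {r s} (a : Vec Gen (suc r)) (b : Vec Gen (suc (suc s))) →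
  AllWords (λ w → last w ≡ last b) (chainW a b)
chainW-last {zero} (_ ∷ []) (_ ∷ _) = map⁺ (All.universal (λ _ → refl) _)
chainW-last {suc r} (_ ∷ as) b = map⁺ (chainW-last as b)

module _ {Q : Gen → Set} where

  chain-Yt-last : ∀ {r} {u : Tens r} → AllWords (Q ∘ last) u → AllWords (Q ∘ last) (chain u Yt)
  chain-Yt-last Qu = chain-AllWords {V = _≡ Y ∷ []} {R = Q ∘ last} keep Qu (refl ∷ [])
    where
    keep : ∀ {a b} → Q (last a) → b ≡ Y ∷ [] → AllWords (Q ∘ last) (chainW a b)
    keep {a} Qa refl = All.map (λ eq → subst Q (sym eq) Qa) (chainW-identityʳ-last a)

  chain-last : ∀ {r s} (u : Tens r) {v : Tens (suc s)} →
    AllWords (Q ∘ last) v → AllWords (Q ∘ last) (chain u v)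
  chain-last u = chain-AllWords {U = λ _ → ⊤} {R = Q ∘ last} keep (All.universal _ u)
    where
    keep : ∀ {a b} → ⊤ → Q (last b) → AllWords (Q ∘ last) (chainW a b)
    keep {a} {b} _ Qb = All.map (λ eq → subst Q (sym eq) Qb) (chainW-last a b)

XorY : Gen → Set
XorY g = g ≡ X ⊎ g ≡ Y

Ppow-last : ∀ k → AllWords (XorY ∘ last) (Ppow (suc k))
Ppow-last zero = chain-Yt-last {XorY} {u = P} (inj₂ refl ∷ inj₁ refl ∷ [])
Ppow-last (suc k) = chain-last {XorY} P (Ppow-last k)

lemma5p4 : (m : ℕ) → 1 ≤ m → (w : Vec Gen (suc (m + 0))) →
    coeff (chain Yt (chain (Ppow m) Yt)) w ≢ 0ℤ → last w ≡ X ⊎ last w ≡ Y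
lemma5p4 (suc k) _ w = AllWords-coeff≢0 (chain-last {XorY} Yt (chain-Yt-last {XorY} (Ppow-last k)))
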